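{- Let $f:\mathbb{Z}_+\to\mathbb{C}$ and $F(x)=1+\sum_{\ell=1}^\infty f(\ell)x^\ell$. Then for every $k\in\mathbb{Z}_+$ and $n\in\mathbb{Z}_{\geq0}$, \[s_n:=\sum_{S\in\mathcal{S}_n^{(k)}}\prod_{i=1}^{|\mathbf{u}(S)|}f(\mathbf{u}(S)_i)=\frac{1}{kn+1}[x^n](1+x)^{kn+1}F(x)^{kn+1},\] and the generating function $S(x)=\sum_{n\geq0}s_nx^n$ satisfies $S(x)=F(xS(x)^k)(1+xS(x)^k)$.
   Context: For $k\in\mathbb{Z}_+$, $\mathcal{S}_n^{(k)}$ (the $k$-Schröder paths of size $n$) is the set of lattice paths from $(0,0)$ to $((k+1)n,0)$ with step set $\{(1,k),(2,k-1),(1,-1)\}$ that never go below the $x$-axis. For $S\in\mathcal{S}_n^{(k)}$, $\mathbf{u}(S)$ is the vector recording, in order, the lengths of the maximal blocks of consecutive $(1,k)$ steps in $S$. Empty products equal $1$. -}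

module Defs where

open import Level using (Level)
open import Data.Nat using (ℕ; zero; suc; _+_; _*_; _∸_)
open import Data.Bool using (Bool; true; false; _∧_)
open import Data.List using (List; []; _∷_; map; _++_; filterᵇ; foldr)
open import Algebra.Bundles using (CommutativeRing)

-- The three steps:  U = (1,k),  H = (2,k-1),  D = (1,-1).
data Step : Set where
  U H D : Step

xlen : Step → ℕ
xlen U = 1
xlen H = 2
xlen D = 1

-- All step words of total x-length exactly L (each word appears once).
words : ℕ → List (List Step)
words zero = [] ∷ []
words (suc zero) = (U ∷ []) ∷ (D ∷ []) ∷ []
words (suc (suc L)) =
  map (U ∷_) (words (suc L)) ++ map (D ∷_) (words (suc L)) ++ map (H ∷_) (words L)

-- Walk from height h (k ≥ 1 is assumed where used, so k ∸ 1 = k - 1);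
-- returns true iff the path never goes below the x-axis and ends at height 0.
validFrom : ℕ → ℕ → List Step → Bool
validFrom k zero [] = true
validFrom k (suc h) [] = false
validFrom k h (U ∷ s) = validFrom k (h + k) s
validFrom k h (H ∷ s) = validFrom k (h + (k ∸ 1)) s
validFrom k zero (D ∷ s) = false
validFrom k (suc h) (D ∷ s) = validFrom k h s

-- 𝒮_n^{(k)} : paths from (0,0) to ((k+1)n,0) with the above steps, never below the x-axis.
schroder : ℕ → ℕ → List (List Step)
schroder k n = filterᵇ (validFrom k 0) (words ((k + 1) * n))

-- u(S): lengths, in order, of the maximal blocks of consecutive U steps.
-- runsAcc c s : c = length of the current (unfinished) U-block.
runsAcc : ℕ → List Step → List ℕ
runsAcc zero [] = []
runsAcc (suc c) [] = suc c ∷ []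
runsAcc c (U ∷ s) = runsAcc (suc c) s
runsAcc zero (H ∷ s) = runsAcc zero s
runsAcc (suc c) (H ∷ s) = suc c ∷ runsAcc zero s
runsAcc zero (D ∷ s) = runsAcc zero s
runsAcc (suc c) (D ∷ s) = suc c ∷ runsAcc zero s

u : List Step → List ℕ
u = runsAcc zero

module WithRing {c ℓ : Level} (R : CommutativeRing c ℓ) where
  open CommutativeRing R public using (Carrier; _≈_)
  open CommutativeRing R using (0#; 1#) renaming (_+_ to _+R_; _*_ to _*R_)

  natMul : ℕ → Carrier → Carrier
  natMul zero r = 0#
  natMul (suc m) r = r +R natMul m r

  sumTo : ℕ → (ℕ → Carrier) → Carrier
  sumTo zero g = g 0
  sumTo (suc n) g = sumTo n g +R g (suc n)

  sumList : List Carrier → Carrier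
  sumList = foldr _+R_ 0#

  prodList : List Carrier → Carrier
  prodList = foldr _*R_ 1#

  Series : Set c
  Series = ℕ → Carrier

  oneS : Series
  oneS zero = 1#
  oneS (suc n) = 0#

  _⊕_ : Series → Series → Series
  (a ⊕ b) n = a n +R b n

  _⊗_ : Series → Series → Series
  (a ⊗ b) n = sumTo n (λ i → a i *R b (n ∸ i))

  _^S_ : Series → ℕ → Series
  a ^S zero = oneS
  a ^S (suc m) = a ⊗ (a ^S m)

  xTimes : Series → Series
  xTimes a zero = 0#
  xTimes a (suc n) = a n

  onePlusX : Series
  onePlusX zero = 1#
  onePlusX (suc zero) = 1#
  onePlusX (suc (suc n)) = 0#

  -- Composition F(G(x)), meaningful when G has zero constant term:
  -- [x^n] F(G) = Σ_{m=0}^{n} F_m [x^n] G^m.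
  compose : Series → Series → Series
  compose F G n = sumTo n (λ m → F m *R (G ^S m) n)

  -- F(x) = 1 + Σ_{ℓ≥1} f(ℓ) x^ℓ   (the value f 0 is never used)
  Fser : (ℕ → Carrier) → Series
  Fser f zero = 1#
  Fser f (suc l) = f (suc l)

  weight : (ℕ → Carrier) → List Step → Carrier
  weight f S = prodList (map f (u S))

  sSeq : (ℕ → Carrier) → ℕ → Series
  sSeq f k n = sumList (map (weight f) (schroder k n))

{-# OPTIONS --safe #-}
-- Cutting a path after its first maximal block of m steps U, which is followed by the end of
-- the path, a step D or a step H, shows that the series P_h of weighted paths from height h
-- down to 0 satisfy P_h = [h = 0] + Σ_m φ_m x^m P_(h+mk−1), with P_(−1) = 0 and φ = (1 + x) F.
-- Induction on the coefficient and then on h gives P_h = S^(h+1) for S = P_0, so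
-- S = φ(x S^k) = F(x S^k) (1 + x S^k).  The recurrence has a unique solution, so P_h is also the
-- sum of Π φ(w_i) over Łukasiewicz words w from height h (letter m a step of height mk − 1).
-- By the cycle lemma exactly one of the kn + 1 rotations of a word of length kn + 1 and
-- total height −1 is Łukasiewicz, so (kn + 1) s_n = [x^n] φ^(kn+1).
module Submission where

open import Defs
open import Level using (Level)
open import Algebra.Bundles using (CommutativeRing; CommutativeSemiring)
import Algebra.Construct.Pointwise
open import Algebra.Structures.Biased using (isCommutativeMonoidˡ; isCommutativeSemiringˡ)
open import Data.Bool using (Bool; true; false; _∧_)
open import Data.Bool.Properties using (∧-zeroʳ; ∧-identityʳ)
open import Data.Empty using (⊥; ⊥-elim)
open import Data.List using (List; []; _∷_; _++_; map; length; take; drop; null; filterᵇ)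
open import Data.List.Properties
  using (map-++; ++-assoc; ++-identityʳ; length-++; length-map; length-take; take++drop≡id)
open import Data.List.Relation.Binary.Permutation.Propositional using (_↭_; ↭-refl; ↭-trans; ↭⇒↭ₛ′)
open import Data.List.Relation.Binary.Permutation.Propositional.Properties using (++-comm; ↭-length; map⁺)
open import Data.List.Relation.Binary.Permutation.Setoid.Properties using (foldr-commMonoid)
open import Data.Nat using (ℕ; zero; suc; _+_; _*_; _∸_; _≤_; _<_; _≡ᵇ_; z≤n; s≤s)
open import Data.Nat.Induction using (<-rec)
open import Data.Nat.ListAction using (sum)
open import Data.Nat.ListAction.Properties using (sum-++; sum-↭)
import Data.Nat.Properties as ℕ
open import Data.Nat.Solver using (module +-*-Solver)
open import Data.Product using (∃; _×_; _,_; proj₁; proj₂)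
open import Data.Sum using (inj₁; inj₂)
open import Relation.Binary.Definitions using (tri<; tri≈; tri>)
open import Relation.Binary.PropositionalEquality as ≡
  using (_≡_; _≢_; refl; cong; cong₂; subst; subst₂; sym; trans; module ≡-Reasoning)
open import Relation.Nullary using (yes; no)
import Relation.Binary.Reasoning.Setoid

-- Rotations and the cycle lemma

rotate : {A : Set} → List A → List A
rotate []      = []
rotate (x ∷ w) = w ++ x ∷ []

rotate^ : {A : Set} → ℕ → List A → List A
rotate^ zero    w = w
rotate^ (suc i) w = rotate^ i (rotate w)

module _ {A : Set} where

  rotate↭ : (w : List A) → rotate w ↭ w
  rotate↭ []      = ↭-refl
  rotate↭ (x ∷ w) = ++-comm w (x ∷ [])

  rotate^↭ : ∀ i (w : List A) → rotate^ i w ↭ w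
  rotate^↭ zero    w = ↭-refl
  rotate^↭ (suc i) w = ↭-trans (rotate^↭ i (rotate w)) (rotate↭ w)

  map-rotate^ : {B : Set} (f : A → B) (i : ℕ) (w : List A) → map f (rotate^ i w) ≡ rotate^ i (map f w)
  map-rotate^ f zero    w       = refl
  map-rotate^ f (suc i) []      = map-rotate^ f i []
  map-rotate^ f (suc i) (x ∷ w) = trans (map-rotate^ f i (w ++ x ∷ [])) (cong (rotate^ i) (map-++ f w (x ∷ [])))

  drop-++ˡ : ∀ i (xs ys : List A) → i ≤ length xs → drop i (xs ++ ys) ≡ drop i xs ++ ys
  drop-++ˡ zero    xs       ys _       = refl
  drop-++ˡ (suc i) (x ∷ xs) ys (s≤s p) = drop-++ˡ i xs ys p

  take-++ˡ : ∀ i (xs ys : List A) → i ≤ length xs → take i (xs ++ ys) ≡ take i xs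
  take-++ˡ zero    xs       ys _       = refl
  take-++ˡ (suc i) (x ∷ xs) ys (s≤s p) = cong (x ∷_) (take-++ˡ i xs ys p)

  take-length-++ : ∀ (xs ys : List A) s → take (length xs + s) (xs ++ ys) ≡ xs ++ take s ys
  take-length-++ []       ys s = refl
  take-length-++ (x ∷ xs) ys s = cong (x ∷_) (take-length-++ xs ys s)

  rotate^-drop-take : ∀ i (w : List A) → i ≤ length w → rotate^ i w ≡ drop i w ++ take i w
  rotate^-drop-take zero    w       _       = sym (++-identityʳ w)
  rotate^-drop-take (suc i) (x ∷ w) (s≤s p) = begin
    rotate^ i (w ++ x ∷ [])                           ≡⟨ rotate^-drop-take i (w ++ x ∷ []) i≤ ⟩
    drop i (w ++ x ∷ []) ++ take i (w ++ x ∷ [])      ≡⟨ cong₂ _++_ (drop-++ˡ i w _ p) (take-++ˡ i w _ p) ⟩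
    (drop i w ++ x ∷ []) ++ take i w                  ≡⟨ ++-assoc (drop i w) (x ∷ []) (take i w) ⟩
    drop i w ++ x ∷ take i w                          ∎
    where
    open ≡-Reasoning
    i≤ : i ≤ length (w ++ x ∷ [])
    i≤ = subst (i ≤_) (sym (length-++ w)) (ℕ.m≤n⇒m≤n+o 1 p)

-- A letter m moves a walk from height h to h + m − 1, through h + m.  returnsFrom h w: the walk
-- never goes below 0 and ends at 0; exitsFrom h w: it first goes below 0 with its last letter.
mutual
  returnsFrom : ℕ → List ℕ → Bool
  returnsFrom h []      = h ≡ᵇ 0
  returnsFrom h (m ∷ w) = returnsDown (h + m) w

  returnsDown : ℕ → List ℕ → Bool
  returnsDown zero    w = false
  returnsDown (suc h) w = returnsFrom h w

mutual
  exitsFrom : ℕ → List ℕ → Bool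
  exitsFrom h []      = false
  exitsFrom h (m ∷ w) = exitsDown (h + m) w

  exitsDown : ℕ → List ℕ → Bool
  exitsDown zero    w = null w
  exitsDown (suc h) w = exitsFrom h w

mutual
  exitsFrom-snoc : ∀ h v m → exitsFrom h (v ++ m ∷ []) ≡ (returnsFrom h v ∧ (m ≡ᵇ 0))
  exitsFrom-snoc zero    []      zero    = refl
  exitsFrom-snoc zero    []      (suc m) = refl
  exitsFrom-snoc (suc h) []      m       = refl
  exitsFrom-snoc h       (x ∷ v) m       = exitsDown-snoc (h + x) v m

  exitsDown-snoc : ∀ p v m → exitsDown p (v ++ m ∷ []) ≡ (returnsDown p v ∧ (m ≡ᵇ 0))
  exitsDown-snoc zero    []      m = refl
  exitsDown-snoc zero    (_ ∷ v) m = refl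
  exitsDown-snoc (suc h) v       m = exitsFrom-snoc h v m

NonNegativePrefixes : ℕ → List ℕ → Set
NonNegativePrefixes h v = ∀ t → 1 ≤ t → t < length v → t ≤ h + sum (take t v)

mutual
  exitsFrom⇒nonNegativePrefixes : ∀ h v → exitsFrom h v ≡ true → NonNegativePrefixes h v
  exitsFrom⇒nonNegativePrefixes h (m ∷ w) ex (suc t) _ (s≤s t<) =
    subst (suc t ≤_) (ℕ.+-assoc h m _) (exitsDown⇒nonNegative (h + m) w ex t t<)

  exitsDown⇒nonNegative : ∀ p w → exitsDown p w ≡ true → ∀ t → t < length w → suc t ≤ p + sum (take t w)
  exitsDown⇒nonNegative zero    (_ ∷ _) () _ _
  exitsDown⇒nonNegative (suc h) w       ex zero    _  = s≤s z≤n
  exitsDown⇒nonNegative (suc h) w       ex (suc t) t< = s≤s (exitsFrom⇒nonNegativePrefixes h w ex (suc t) (s≤s z≤n) t<)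

mutual
  nonNegativePrefixes⇒exitsFrom : ∀ h v → suc (h + sum v) ≡ length v →
    NonNegativePrefixes h v → exitsFrom h v ≡ true
  nonNegativePrefixes⇒exitsFrom h (m ∷ w) len nn =
    nonNegative⇒exitsDown (h + m) w (trans (cong suc (ℕ.+-assoc h m (sum w))) len)
      (λ t t< → subst (suc t ≤_) (sym (ℕ.+-assoc h m _)) (nn (suc t) (s≤s z≤n) (s≤s t<)))

  nonNegative⇒exitsDown : ∀ p w → suc (p + sum w) ≡ suc (length w) →
    (∀ t → t < length w → suc t ≤ p + sum (take t w)) → exitsDown p w ≡ true
  nonNegative⇒exitsDown zero    []      _   _  = refl
  nonNegative⇒exitsDown zero    (_ ∷ _) _   nn with nn zero (s≤s z≤n)
  ... | ()
  nonNegative⇒exitsDown (suc h) w       len nn = nonNegativePrefixes⇒exitsFrom h w (ℕ.suc-injective len)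
    (λ { (suc t) _ t< → ℕ.≤-pred (nn (suc t) t<) })

firstMinimiser : (A : ℕ → ℕ) (M : ℕ) → ∃ λ i → i ≤ M
  × (∀ s → s ≤ M → A i + s ≤ A s + i)
  × (∀ s → s < i → A i + s < A s + i)
firstMinimiser A zero = 0 , z≤n , (λ { zero z≤n → ℕ.≤-refl }) , (λ _ ())
firstMinimiser A (suc M) with firstMinimiser A M
... | i , i≤M , min , first with A i + suc M ℕ.≤? A (suc M) + i
...   | yes keep = i , ℕ.m≤n⇒m≤1+n i≤M , min′ , first
  where
  min′ : ∀ s → s ≤ suc M → A i + s ≤ A s + i
  min′ s s≤ with ℕ.m≤n⇒m<n∨m≡n s≤
  ... | inj₁ (s≤s s≤M) = min s s≤M
  ... | inj₂ refl      = keep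
...   | no new = suc M , ℕ.≤-refl , below , λ { s (s≤s s≤M) → below′ s s≤M }
  where
  open +-*-Solver
  below′ : ∀ s → s ≤ M → A (suc M) + s < A s + suc M
  below′ s s≤M = ℕ.+-cancelʳ-< (A i + i) _ _ (subst₂ _<_
    (solve 4 (λ a b x y → (a :+ b) :+ (x :+ y) := (a :+ y) :+ (x :+ b)) refl (A (suc M)) i (A i) s)
    (solve 4 (λ a b x y → (a :+ b) :+ (x :+ y) := (x :+ b) :+ (a :+ y)) refl (A i) (suc M) (A s) i)
    (ℕ.+-mono-<-≤ (ℕ.≰⇒> new) (min s s≤M)))
  below : ∀ s → s ≤ suc M → A (suc M) + s ≤ A s + suc M
  below s s≤ with ℕ.m≤n⇒m<n∨m≡n s≤
  ... | inj₁ (s≤s s≤M) = ℕ.<⇒≤ (below′ s s≤M)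
  ... | inj₂ refl      = ℕ.≤-refl

module _ (M : ℕ) (w : List ℕ) (length-w : length w ≡ suc M) (sum-w : sum w ≡ M) where

  private
    prefixSum : ℕ → ℕ
    prefixSum s = sum (take s (w ++ w))

    -- prefixSum s − s is the height after s letters of the walk along w ++ w; Good i says
    -- that none of the next M heights is below the one at i.
    Good : ℕ → Set
    Good i = ∀ t → 1 ≤ t → t ≤ M → prefixSum i + t ≤ prefixSum (i + t)

    ≤M⇒≤length : ∀ {i} → i ≤ M → i ≤ length w
    ≤M⇒≤length i≤M = subst (_ ≤_) (sym length-w) (ℕ.m≤n⇒m≤1+n i≤M)

    prefixSum-small : ∀ s → s ≤ length w → prefixSum s ≡ sum (take s w)
    prefixSum-small s s≤ = cong sum (take-++ˡ s w w s≤)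

    prefixSum-shift : ∀ s → s ≤ length w → prefixSum (length w + s) ≡ M + prefixSum s
    prefixSum-shift s s≤ = begin
      sum (take (length w + s) (w ++ w)) ≡⟨ cong sum (take-length-++ w w s) ⟩
      sum (w ++ take s w)                ≡⟨ sum-++ w (take s w) ⟩
      sum w + sum (take s w)             ≡⟨ cong₂ _+_ sum-w (sym (prefixSum-small s s≤)) ⟩
      M + prefixSum s                    ∎
      where open ≡-Reasoning

    prefixSum-rotate^ : ∀ i t → i ≤ M → t ≤ length w →
      prefixSum i + sum (take t (rotate^ i w)) ≡ prefixSum (i + t)
    prefixSum-rotate^ i t i≤M t≤ = begin
      prefixSum i + sum (take t R)                      ≡⟨ cong (_+ sum (take t R)) (prefixSum-small i i≤) ⟩
      sum (take i w) + sum (take t R)                   ≡⟨ cong (λ z → sum (take i w) + sum z) (take-++ˡ t R (drop i w) t≤R) ⟨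
      sum (take i w) + sum (take t (R ++ drop i w))     ≡⟨ sum-++ (take i w) _ ⟨
      sum (take i w ++ take t (R ++ drop i w))          ≡⟨ cong sum (take-length-++ (take i w) _ t) ⟨
      sum (take (length (take i w) + t) (take i w ++ R ++ drop i w))
                                                        ≡⟨ cong₂ (λ a b → sum (take (a + t) b)) length-take-i split ⟩
      prefixSum (i + t)                                 ∎
      where
      open ≡-Reasoning
      R = rotate^ i w
      i≤ = ≤M⇒≤length i≤M
      t≤R : t ≤ length R
      t≤R = subst (t ≤_) (sym (↭-length (rotate^↭ i w))) t≤
      length-take-i : length (take i w) ≡ i
      length-take-i = trans (length-take i w) (ℕ.m≤n⇒m⊓n≡m i≤)
      split : take i w ++ R ++ drop i w ≡ w ++ w
      split = begin
        take i w ++ R ++ drop i w                           ≡⟨ cong (λ z → take i w ++ z ++ drop i w) (rotate^-drop-take i w i≤) ⟩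
        take i w ++ (drop i w ++ take i w) ++ drop i w      ≡⟨ cong (take i w ++_) (++-assoc (drop i w) (take i w) (drop i w)) ⟩
        take i w ++ drop i w ++ take i w ++ drop i w        ≡⟨ ++-assoc (take i w) (drop i w) _ ⟨
        (take i w ++ drop i w) ++ take i w ++ drop i w      ≡⟨ cong (λ z → z ++ z) (take++drop≡id i w) ⟩
        w ++ w                                              ∎

    length-rotate^ : ∀ i → length (rotate^ i w) ≡ suc M
    length-rotate^ i = trans (↭-length (rotate^↭ i w)) length-w

    exitsFrom⇒good : ∀ i → i ≤ M → exitsFrom 0 (rotate^ i w) ≡ true → Good i
    exitsFrom⇒good i i≤M ex t 1≤t t≤M =
      subst (prefixSum i + t ≤_) (prefixSum-rotate^ i t i≤M (≤M⇒≤length t≤M))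
        (ℕ.+-monoʳ-≤ (prefixSum i) (exitsFrom⇒nonNegativePrefixes 0 _ ex t 1≤t t<))
      where
      t< : t < length (rotate^ i w)
      t< = subst (t <_) (sym (length-rotate^ i)) (s≤s t≤M)

    good⇒exitsFrom : ∀ i → i ≤ M → Good i → exitsFrom 0 (rotate^ i w) ≡ true
    good⇒exitsFrom i i≤M good = nonNegativePrefixes⇒exitsFrom 0 (rotate^ i w) len nonNeg
      where
      len : suc (sum (rotate^ i w)) ≡ length (rotate^ i w)
      len = trans (cong suc (trans (sum-↭ (rotate^↭ i w)) sum-w)) (sym (length-rotate^ i))
      nonNeg : NonNegativePrefixes 0 (rotate^ i w)
      nonNeg t 1≤t t< = ℕ.+-cancelˡ-≤ (prefixSum i) _ _
        (subst (prefixSum i + t ≤_) (sym (prefixSum-rotate^ i t i≤M (≤M⇒≤length t≤M))) (good t 1≤t t≤M))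
        where
        t≤M : t ≤ M
        t≤M = ℕ.≤-pred (subst (t <_) (length-rotate^ i) t<)

    good-exists : ∃ λ i → i ≤ M × Good i
    good-exists with firstMinimiser prefixSum M
    ... | i , i≤M , minimal , first = i , i≤M , good
      where
      open +-*-Solver
      good : Good i
      good t _ t≤M with i + t ℕ.≤? M
      ... | yes i+t≤M = ℕ.+-cancelʳ-≤ i _ _ (subst (_≤ prefixSum (i + t) + i)
        (solve 3 (λ a x y → a :+ (x :+ y) := (a :+ y) :+ x) refl (prefixSum i) i t) (minimal (i + t) i+t≤M))
      ... | no  i+t≰M = ℕ.+-cancelʳ-≤ i _ _ (begin
        prefixSum i + t + i       ≡⟨ solve 3 (λ a x y → (a :+ y) :+ x := a :+ (x :+ y)) refl (prefixSum i) i t ⟩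
        prefixSum i + (i + t)     ≡⟨ cong (prefixSum i +_) wrap ⟨
        prefixSum i + (suc M + s) ≡⟨ solve 3 (λ a m x → a :+ ((con 1 :+ m) :+ x) := m :+ (con 1 :+ (a :+ x))) refl (prefixSum i) M s ⟩
        M + suc (prefixSum i + s) ≤⟨ ℕ.+-monoʳ-≤ M (first s s<i) ⟩
        M + (prefixSum s + i)     ≡⟨ ℕ.+-assoc M (prefixSum s) i ⟨
        M + prefixSum s + i       ≡⟨ cong (_+ i) (prefixSum-shift s s≤) ⟨
        prefixSum (length w + s) + i ≡⟨ cong (λ z → prefixSum (z + s) + i) length-w ⟩
        prefixSum (suc M + s) + i ≡⟨ cong (λ z → prefixSum z + i) wrap ⟩
        prefixSum (i + t) + i     ∎)
        where
        open ℕ.≤-Reasoning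
        s = proj₁ (ℕ.m≤n⇒∃[o]m+o≡n (ℕ.≰⇒> i+t≰M))
        wrap : suc M + s ≡ i + t
        wrap = proj₂ (ℕ.m≤n⇒∃[o]m+o≡n (ℕ.≰⇒> i+t≰M))
        s<i : s < i
        s<i = ℕ.+-cancelʳ-≤ M _ _ (begin
          suc s + M ≡⟨ cong suc (ℕ.+-comm s M) ⟩
          suc M + s ≡⟨ wrap ⟩
          i + t     ≤⟨ ℕ.+-monoʳ-≤ i t≤M ⟩
          i + M     ∎)
        s≤ : s ≤ length w
        s≤ = ≤M⇒≤length (ℕ.≤-trans (ℕ.<⇒≤ s<i) i≤M)

    good-unique : ∀ i j → i < j → j ≤ M → Good i → Good j → ⊥
    good-unique i j i<j j≤M good-i good-j = ℕ.1+n≰n (begin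
      suc (M + prefixSum i)     ≡⟨ trans (cong suc (ℕ.+-comm M (prefixSum i))) (sym (ℕ.+-suc (prefixSum i) M)) ⟩
      prefixSum i + suc M       ≡⟨ cong (prefixSum i +_) d+t ⟨
      prefixSum i + (suc d + t) ≡⟨ ℕ.+-assoc (prefixSum i) (suc d) t ⟨
      prefixSum i + suc d + t   ≤⟨ ℕ.+-monoˡ-≤ t (subst (λ z → prefixSum i + suc d ≤ prefixSum z) i+d (good-i (suc d) (s≤s z≤n) d<M)) ⟩
      prefixSum j + t           ≤⟨ good-j t (s≤s z≤n) t≤M ⟩
      prefixSum (j + t)         ≡⟨ cong prefixSum j+t ⟩
      prefixSum (length w + i)  ≡⟨ prefixSum-shift i (≤M⇒≤length (ℕ.≤-trans (ℕ.<⇒≤ i<j) j≤M)) ⟩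
      M + prefixSum i           ∎)
      where
      open +-*-Solver
      open ℕ.≤-Reasoning
      d = proj₁ (ℕ.m≤n⇒∃[o]m+o≡n i<j)
      e = proj₁ (ℕ.m≤n⇒∃[o]m+o≡n j≤M)
      t = suc e + i
      i+d : i + suc d ≡ j
      i+d = trans (ℕ.+-suc i d) (proj₂ (ℕ.m≤n⇒∃[o]m+o≡n i<j))
      j+e : j + e ≡ M
      j+e = proj₂ (ℕ.m≤n⇒∃[o]m+o≡n j≤M)
      M≡ : i + suc d + e ≡ M
      M≡ = trans (cong (_+ e) i+d) j+e
      d+t : suc d + t ≡ suc M
      d+t = trans (solve 3 (λ x d e → (con 1 :+ d) :+ ((con 1 :+ e) :+ x) := con 1 :+ ((x :+ (con 1 :+ d)) :+ e)) refl i d e)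
                  (cong suc M≡)
      d<M : suc d ≤ M
      d<M = subst (suc d ≤_) M≡ (ℕ.≤-trans (ℕ.m≤n+m (suc d) i) (ℕ.m≤m+n (i + suc d) e))
      t≤M : t ≤ M
      t≤M = subst (t ≤_) M≡ (subst (t ≤_) (solve 3 (λ x d e → ((con 1 :+ e) :+ x) :+ d := (x :+ (con 1 :+ d)) :+ e) refl i d e)
                                    (ℕ.m≤m+n t d))
      j+t : j + t ≡ length w + i
      j+t = begin-equality
        j + (suc e + i)  ≡⟨ solve 3 (λ j e x → j :+ ((con 1 :+ e) :+ x) := (con 1 :+ (j :+ e)) :+ x) refl j e i ⟩
        suc (j + e) + i  ≡⟨ cong (λ z → suc z + i) j+e ⟩
        suc M + i        ≡⟨ cong (_+ i) length-w ⟨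
        length w + i     ∎

  cycle-lemma : ∃ λ i → i ≤ M × exitsFrom 0 (rotate^ i w) ≡ true
    × (∀ j → j ≤ M → exitsFrom 0 (rotate^ j w) ≡ true → j ≡ i)
  cycle-lemma with good-exists
  ... | i , i≤M , good-i = i , i≤M , good⇒exitsFrom i i≤M good-i , unique
    where
    unique : ∀ j → j ≤ M → exitsFrom 0 (rotate^ j w) ≡ true → j ≡ i
    unique j j≤M ex with ℕ.<-cmp j i
    ... | tri≈ _ j≡i _ = j≡i
    ... | tri< j<i _ _ = ⊥-elim (good-unique j i j<i i≤M (exitsFrom⇒good j j≤M ex) good-i)
    ... | tri> _ _ i<j = ⊥-elim (good-unique i j i<j j≤M good-i (exitsFrom⇒good j j≤M ex))

sum-map-*ʳ : ∀ k (w : List ℕ) → sum (map (_* k) w) ≡ sum w * k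
sum-map-*ʳ k []      = refl
sum-map-*ʳ k (m ∷ w) = trans (cong (m * k +_) (sum-map-*ʳ k w)) (sym (ℕ.*-distribʳ-+ k m (sum w)))

-- Finite sums and formal power series

module PowerSeries {c ℓ : Level} (R : CommutativeRing c ℓ) where

  open WithRing R
  open CommutativeRing R hiding (Carrier; _≈_; _+_; _*_; zero; refl; sym; trans)
  open CommutativeRing R using ()
    renaming (_+_ to _+ᴿ_; _*_ to _*ᴿ_; refl to ≈-refl; sym to ≈-sym; trans to ≈-trans)
  open import Relation.Binary.Reasoning.Setoid setoid
  open import Algebra.Properties.CommutativeSemigroup +-commutativeSemigroup using () renaming (interchange to +-interchange)
  open import Algebra.Properties.CommutativeSemigroup *-commutativeSemigroup using () renaming (x∙yz≈y∙xz to x*yz≈y*xz)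

  sumTo-cong : ∀ n {g h : ℕ → Carrier} → (∀ i → i ≤ n → g i ≈ h i) → sumTo n g ≈ sumTo n h
  sumTo-cong zero    g≈h = g≈h 0 z≤n
  sumTo-cong (suc n) g≈h = +-cong (sumTo-cong n (λ i i≤n → g≈h i (ℕ.m≤n⇒m≤1+n i≤n))) (g≈h (suc n) ℕ.≤-refl)

  sumTo-zero : ∀ n {g : ℕ → Carrier} → (∀ i → i ≤ n → g i ≈ 0#) → sumTo n g ≈ 0#
  sumTo-zero zero    g≈0 = g≈0 0 z≤n
  sumTo-zero (suc n) g≈0 =
    ≈-trans (+-cong (sumTo-zero n (λ i i≤n → g≈0 i (ℕ.m≤n⇒m≤1+n i≤n))) (g≈0 (suc n) ℕ.≤-refl)) (+-identityʳ 0#)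

  sumTo-+ : ∀ n (g h : ℕ → Carrier) → sumTo n (λ i → g i +ᴿ h i) ≈ sumTo n g +ᴿ sumTo n h
  sumTo-+ zero    g h = ≈-refl
  sumTo-+ (suc n) g h = ≈-trans (+-congʳ (sumTo-+ n g h)) (+-interchange _ _ _ _)

  *-distribˡ-sumTo : ∀ n a (g : ℕ → Carrier) → a *ᴿ sumTo n g ≈ sumTo n (λ i → a *ᴿ g i)
  *-distribˡ-sumTo zero    a g = ≈-refl
  *-distribˡ-sumTo (suc n) a g = ≈-trans (distribˡ a _ _) (+-congʳ (*-distribˡ-sumTo n a g))

  *-distribʳ-sumTo : ∀ n a (g : ℕ → Carrier) → sumTo n g *ᴿ a ≈ sumTo n (λ i → g i *ᴿ a)
  *-distribʳ-sumTo zero    a g = ≈-refl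
  *-distribʳ-sumTo (suc n) a g = ≈-trans (distribʳ a _ _) (+-congʳ (*-distribʳ-sumTo n a g))

  sumTo-suc : ∀ n (g : ℕ → Carrier) → sumTo (suc n) g ≈ g 0 +ᴿ sumTo n (λ i → g (suc i))
  sumTo-suc zero    g = ≈-refl
  sumTo-suc (suc n) g = ≈-trans (+-congʳ (sumTo-suc n g)) (+-assoc _ _ _)

  sumTo-reverse : ∀ n (g : ℕ → Carrier) → sumTo n g ≈ sumTo n (λ i → g (n ∸ i))
  sumTo-reverse zero    g = ≈-refl
  sumTo-reverse (suc n) g = begin
    sumTo n g +ᴿ g (suc n)                   ≈⟨ +-comm _ _ ⟩
    g (suc n) +ᴿ sumTo n g                   ≈⟨ +-congˡ (sumTo-reverse n g) ⟩
    g (suc n) +ᴿ sumTo n (λ i → g (n ∸ i))   ≈⟨ sumTo-suc n (λ i → g (suc n ∸ i)) ⟨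
    sumTo (suc n) (λ i → g (suc n ∸ i))     ∎

  sumTo-triangle : ∀ n (g : ℕ → ℕ → ℕ → Carrier) →
    sumTo n (λ l → sumTo l (λ i → g i (l ∸ i) (n ∸ l)))
      ≈ sumTo n (λ i → sumTo (n ∸ i) (λ j → g i j (n ∸ i ∸ j)))
  sumTo-triangle zero    g = ≈-refl
  sumTo-triangle (suc n) g = begin
    sumTo (suc n) (λ l → sumTo l (λ i → g i (l ∸ i) (suc n ∸ l)))
      ≈⟨ sumTo-suc n _ ⟩
    g 0 0 (suc n) +ᴿ sumTo n (λ l → sumTo (suc l) (λ i → g i (suc l ∸ i) (n ∸ l)))
      ≈⟨ +-congˡ (sumTo-cong n (λ l _ → sumTo-suc l _)) ⟩
    g 0 0 (suc n) +ᴿ sumTo n (λ l → g 0 (suc l) (n ∸ l) +ᴿ sumTo l (λ i → g (suc i) (l ∸ i) (n ∸ l)))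
      ≈⟨ +-congˡ (sumTo-+ n _ _) ⟩
    g 0 0 (suc n) +ᴿ (sumTo n (λ l → g 0 (suc l) (n ∸ l)) +ᴿ sumTo n (λ l → sumTo l (λ i → g (suc i) (l ∸ i) (n ∸ l))))
      ≈⟨ +-assoc _ _ _ ⟨
    (g 0 0 (suc n) +ᴿ sumTo n (λ l → g 0 (suc l) (n ∸ l))) +ᴿ sumTo n (λ l → sumTo l (λ i → g (suc i) (l ∸ i) (n ∸ l)))
      ≈⟨ +-cong (≈-sym (sumTo-suc n (λ j → g 0 j (suc n ∸ j)))) (sumTo-triangle n (λ i → g (suc i))) ⟩
    sumTo (suc n) (λ j → g 0 j (suc n ∸ j)) +ᴿ sumTo n (λ i → sumTo (n ∸ i) (λ j → g (suc i) j (n ∸ i ∸ j)))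
      ≈⟨ sumTo-suc n _ ⟨
    sumTo (suc n) (λ i → sumTo (suc n ∸ i) (λ j → g i j (suc n ∸ i ∸ j))) ∎

  sumTo-triangle-comm : ∀ n (g : ℕ → ℕ → ℕ → Carrier) →
    sumTo n (λ i → sumTo (n ∸ i) (λ j → g i j (n ∸ i ∸ j)))
      ≈ sumTo n (λ j → sumTo (n ∸ j) (λ i → g i j (n ∸ j ∸ i)))
  sumTo-triangle-comm n g = begin
    sumTo n (λ i → sumTo (n ∸ i) (λ j → g i j (n ∸ i ∸ j)))  ≈⟨ sumTo-triangle n g ⟨
    sumTo n (λ l → sumTo l (λ i → g i (l ∸ i) (n ∸ l)))      ≈⟨ sumTo-cong n (λ l _ → sumTo-reverse l _) ⟩
    sumTo n (λ l → sumTo l (λ j → g (l ∸ j) (l ∸ (l ∸ j)) (n ∸ l)))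
      ≈⟨ sumTo-cong n (λ l _ → sumTo-cong l (λ j j≤l → reflexive (cong (λ z → g (l ∸ j) z (n ∸ l)) (ℕ.m∸[m∸n]≡n j≤l)))) ⟩
    sumTo n (λ l → sumTo l (λ j → g (l ∸ j) j (n ∸ l)))      ≈⟨ sumTo-triangle n (λ j i → g i j) ⟩
    sumTo n (λ j → sumTo (n ∸ j) (λ i → g i j (n ∸ j ∸ i)))  ∎

  sumTo-const : ∀ n x → sumTo n (λ _ → x) ≈ natMul (suc n) x
  sumTo-const zero    x = ≈-sym (+-identityʳ x)
  sumTo-const (suc n) x = ≈-trans (+-congʳ (sumTo-const n x)) (+-comm _ x)

  natMul-cong : ∀ n {x y} → x ≈ y → natMul n x ≈ natMul n y
  natMul-cong zero    x≈y = ≈-refl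
  natMul-cong (suc n) x≈y = +-cong x≈y (natMul-cong n x≈y)

  indicator : Bool → Carrier
  indicator true  = 1#
  indicator false = 0#

  sumTo-single : ∀ n i {g : ℕ → Carrier} → i ≤ n → (∀ j → j ≤ n → j ≢ i → g j ≈ 0#) → sumTo n g ≈ g i
  sumTo-single zero    .zero z≤n  _    = ≈-refl
  sumTo-single (suc n) i     i≤1+n g≈0 with ℕ.m≤n⇒m<n∨m≡n i≤1+n
  ... | inj₁ (s≤s i≤n) = ≈-trans (+-cong (sumTo-single n i i≤n (λ j j≤n → g≈0 j (ℕ.m≤n⇒m≤1+n j≤n)))
                                         (g≈0 (suc n) ℕ.≤-refl (λ { refl → ℕ.1+n≰n i≤n })))
                                 (+-identityʳ _)
  ... | inj₂ refl      = ≈-trans (+-congʳ (sumTo-zero n (λ j j≤n → g≈0 j (ℕ.m≤n⇒m≤1+n j≤n) (λ { refl → ℕ.1+n≰n j≤n }))))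
                                 (+-identityˡ _)

  sumTo-indicator-unique : ∀ n (p : ℕ → Bool) i → i ≤ n → p i ≡ true →
    (∀ j → j ≤ n → p j ≡ true → j ≡ i) → sumTo n (λ j → indicator (p j)) ≈ 1#
  sumTo-indicator-unique n p i i≤n pi unique =
    ≈-trans (sumTo-single n i i≤n elsewhere) (reflexive (cong indicator pi))
    where
    elsewhere : ∀ j → j ≤ n → j ≢ i → indicator (p j) ≈ 0#
    elsewhere j j≤n j≢i with p j in pj
    ... | true  = ⊥-elim (j≢i (unique j j≤n pj))
    ... | false = ≈-refl

  sumList-filter-map : ∀ {A B : Set} (p : B → Bool) (q : A → Bool) (g : B → Carrier) (g′ : A → Carrier)
    (e : A → B) xs → (∀ x → p (e x) ≡ q x) → (∀ x → g (e x) ≈ g′ x) →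
    sumList (map g (filterᵇ p (map e xs))) ≈ sumList (map g′ (filterᵇ q xs))
  sumList-filter-map p q g g′ e []       p≡q g≈g′ = ≈-refl
  sumList-filter-map p q g g′ e (x ∷ xs) p≡q g≈g′ with p (e x) | q x | p≡q x
  ... | true  | .true  | refl = +-cong (g≈g′ x) (sumList-filter-map p q g g′ e xs p≡q g≈g′)
  ... | false | .false | refl = sumList-filter-map p q g g′ e xs p≡q g≈g′

  *-distribˡ-sumList : ∀ {A : Set} a (g : A → Carrier) xs → a *ᴿ sumList (map g xs) ≈ sumList (map (λ x → a *ᴿ g x) xs)
  *-distribˡ-sumList a g []       = zeroʳ a
  *-distribˡ-sumList a g (x ∷ xs) = ≈-trans (distribˡ a _ _) (+-congˡ (*-distribˡ-sumList a g xs))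

  infix 4 _≋_
  _≋_ : Series → Series → Set ℓ
  a ≋ b = ∀ n → a n ≈ b n

  zeroS : Series
  zeroS _ = 0#

  ⊗-cong : ∀ {a a′ b b′} → a ≋ a′ → b ≋ b′ → a ⊗ b ≋ a′ ⊗ b′
  ⊗-cong a≋a′ b≋b′ n = sumTo-cong n (λ i _ → *-cong (a≋a′ i) (b≋b′ (n ∸ i)))

  ⊗-comm : ∀ a b → a ⊗ b ≋ b ⊗ a
  ⊗-comm a b n = begin
    sumTo n (λ i → a i *ᴿ b (n ∸ i))                 ≈⟨ sumTo-reverse n _ ⟩
    sumTo n (λ i → a (n ∸ i) *ᴿ b (n ∸ (n ∸ i)))     ≈⟨ sumTo-cong n (λ i i≤n → ≈-trans (*-comm _ _) (*-congʳ (reflexive (cong b (ℕ.m∸[m∸n]≡n i≤n))))) ⟩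
    sumTo n (λ i → b i *ᴿ a (n ∸ i))                 ∎

  ⊗-assoc : ∀ a b d → (a ⊗ b) ⊗ d ≋ a ⊗ (b ⊗ d)
  ⊗-assoc a b d n = begin
    sumTo n (λ l → sumTo l (λ i → a i *ᴿ b (l ∸ i)) *ᴿ d (n ∸ l))
      ≈⟨ sumTo-cong n (λ l _ → *-distribʳ-sumTo l _ _) ⟩
    sumTo n (λ l → sumTo l (λ i → a i *ᴿ b (l ∸ i) *ᴿ d (n ∸ l)))
      ≈⟨ sumTo-triangle n (λ i j r → a i *ᴿ b j *ᴿ d r) ⟩
    sumTo n (λ i → sumTo (n ∸ i) (λ j → a i *ᴿ b j *ᴿ d (n ∸ i ∸ j)))
      ≈⟨ sumTo-cong n (λ i _ → ≈-trans (sumTo-cong (n ∸ i) (λ j _ → *-assoc _ _ _)) (≈-sym (*-distribˡ-sumTo (n ∸ i) _ _))) ⟩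
    sumTo n (λ i → a i *ᴿ sumTo (n ∸ i) (λ j → b j *ᴿ d (n ∸ i ∸ j))) ∎

  ⊗-identityˡ : ∀ a → oneS ⊗ a ≋ a
  ⊗-identityˡ a zero    = *-identityˡ _
  ⊗-identityˡ a (suc n) = begin
    sumTo (suc n) (λ i → oneS i *ᴿ a (suc n ∸ i))            ≈⟨ sumTo-suc n _ ⟩
    1# *ᴿ a (suc n) +ᴿ sumTo n (λ i → 0# *ᴿ a (n ∸ i))       ≈⟨ +-cong (*-identityˡ _) (sumTo-zero n (λ i _ → zeroˡ _)) ⟩
    a (suc n) +ᴿ 0#                                          ≈⟨ +-identityʳ _ ⟩
    a (suc n)                                                ∎

  ⊗-distribʳ : ∀ a b d → (b ⊕ d) ⊗ a ≋ (b ⊗ a) ⊕ (d ⊗ a)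
  ⊗-distribʳ a b d n = ≈-trans (sumTo-cong n (λ i _ → distribʳ _ _ _)) (sumTo-+ n _ _)

  ⊗-zeroˡ : ∀ a → zeroS ⊗ a ≋ zeroS
  ⊗-zeroˡ a n = sumTo-zero n (λ i _ → zeroˡ _)

  seriesSemiring : CommutativeSemiring c ℓ
  seriesSemiring = record
    { Carrier = Series ; _≈_ = _≋_ ; _+_ = _⊕_ ; _*_ = _⊗_ ; 0# = zeroS ; 1# = oneS
    ; isCommutativeSemiring = isCommutativeSemiringˡ record
      { +-isCommutativeMonoid = Pointwise.isCommutativeMonoid +-isCommutativeMonoid
      ; *-isCommutativeMonoid = isCommutativeMonoidˡ record
        { isSemigroup = record
          { isMagma = record { isEquivalence = Pointwise.isEquivalence isEquivalence ; ∙-cong = ⊗-cong }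
          ; assoc = ⊗-assoc }
        ; identityˡ = ⊗-identityˡ
        ; comm = ⊗-comm }
      ; distribʳ = ⊗-distribʳ
      ; zeroˡ = ⊗-zeroˡ } }
    where module Pointwise = Algebra.Construct.Pointwise ℕ

  open CommutativeSemiring seriesSemiring using ()
    renaming ( refl to ≋-refl; sym to ≋-sym; trans to ≋-trans
             ; *-congˡ to ⊗-congˡ; *-congʳ to ⊗-congʳ; *-identityʳ to ⊗-identityʳ; distribˡ to ⊗-distribˡ)
  open import Algebra.Properties.CommutativeSemiring.Exp seriesSemiring
    using (_^_; ^-congˡ; ^-homo-*; ^-assocʳ; ^-distrib-*)

  ^S≋^ : ∀ a m → a ^S m ≋ a ^ m
  ^S≋^ a zero    n = ≈-refl
  ^S≋^ a (suc m)   = ⊗-cong (λ _ → ≈-refl) (^S≋^ a m)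

  ^S-+ : ∀ a m n → a ^S (m + n) ≋ (a ^S m) ⊗ (a ^S n)
  ^S-+ a m n = ≋-trans (^S≋^ a (m + n)) (≋-trans (^-homo-* a m n) (⊗-cong (≋-sym (^S≋^ a m)) (≋-sym (^S≋^ a n))))

  ^S-* : ∀ a m n → (a ^S m) ^S n ≋ a ^S (m * n)
  ^S-* a m n = ≋-trans (^S≋^ (a ^S m) n)
    (≋-trans (^-congˡ n (^S≋^ a m)) (≋-trans (^-assocʳ a m n) (≋-sym (^S≋^ a (m * n)))))

  ^S-distrib-⊗ : ∀ a b m → (a ⊗ b) ^S m ≋ (a ^S m) ⊗ (b ^S m)
  ^S-distrib-⊗ a b m = ≋-trans (^S≋^ (a ⊗ b) m) (≋-trans (^-distrib-* a b m) (⊗-cong (≋-sym (^S≋^ a m)) (≋-sym (^S≋^ b m))))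

  xTimes-cong : ∀ {a b} → a ≋ b → xTimes a ≋ xTimes b
  xTimes-cong a≋b zero    = ≈-refl
  xTimes-cong a≋b (suc n) = a≋b n

  xTimes-⊗ : ∀ a b → xTimes a ⊗ b ≋ xTimes (a ⊗ b)
  xTimes-⊗ a b zero    = zeroˡ _
  xTimes-⊗ a b (suc n) = begin
    sumTo (suc n) (λ i → xTimes a i *ᴿ b (suc n ∸ i))         ≈⟨ sumTo-suc n _ ⟩
    0# *ᴿ b (suc n) +ᴿ sumTo n (λ i → a i *ᴿ b (n ∸ i))      ≈⟨ +-congʳ (zeroˡ _) ⟩
    0# +ᴿ sumTo n (λ i → a i *ᴿ b (n ∸ i))                   ≈⟨ +-identityˡ _ ⟩
    (a ⊗ b) n                                                ∎

  ⊗-xTimes : ∀ a b → a ⊗ xTimes b ≋ xTimes (a ⊗ b)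
  ⊗-xTimes a b = ≋-trans (⊗-comm a (xTimes b)) (≋-trans (xTimes-⊗ b a) (xTimes-cong (⊗-comm b a)))

  onePlusX-⊗ : ∀ a → onePlusX ⊗ a ≋ a ⊕ xTimes a
  onePlusX-⊗ a zero    = ≈-trans (*-identityˡ _) (≈-sym (+-identityʳ _))
  onePlusX-⊗ a (suc n) = begin
    sumTo (suc n) (λ i → onePlusX i *ᴿ a (suc n ∸ i))                  ≈⟨ sumTo-suc n _ ⟩
    1# *ᴿ a (suc n) +ᴿ sumTo n (λ i → onePlusX (suc i) *ᴿ a (n ∸ i))   ≈⟨ +-cong (*-identityˡ _) (tail n) ⟩
    a (suc n) +ᴿ a n                                                   ∎
    where
    tail : ∀ n → sumTo n (λ i → onePlusX (suc i) *ᴿ a (n ∸ i)) ≈ a n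
    tail zero    = *-identityˡ _
    tail (suc n) = begin
      sumTo (suc n) (λ i → onePlusX (suc i) *ᴿ a (suc n ∸ i))          ≈⟨ sumTo-suc n _ ⟩
      1# *ᴿ a (suc n) +ᴿ sumTo n (λ i → 0# *ᴿ a (n ∸ i))               ≈⟨ +-cong (*-identityˡ _) (sumTo-zero n (λ i _ → zeroˡ _)) ⟩
      a (suc n) +ᴿ 0#                                                  ≈⟨ +-identityʳ _ ⟩
      a (suc n)                                                        ∎

  shiftBy : ℕ → Series → Series
  shiftBy zero    a = a
  shiftBy (suc m) a = xTimes (shiftBy m a)

  shiftBy-coeff : ∀ m a n → m ≤ n → shiftBy m a n ≡ a (n ∸ m)
  shiftBy-coeff zero    a n       _       = refl
  shiftBy-coeff (suc m) a (suc n) (s≤s p) = shiftBy-coeff m a n p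

  ⊗-shiftBy : ∀ m a b → a ⊗ shiftBy m b ≋ shiftBy m (a ⊗ b)
  ⊗-shiftBy zero    a b = ≋-refl
  ⊗-shiftBy (suc m) a b = ≋-trans (⊗-xTimes a (shiftBy m b)) (xTimes-cong (⊗-shiftBy m a b))

  xTimes-^S : ∀ a m → xTimes a ^S m ≋ shiftBy m (a ^S m)
  xTimes-^S a zero    = ≋-refl
  xTimes-^S a (suc m) =
    ≋-trans (⊗-congˡ (xTimes-^S a m)) (≋-trans (xTimes-⊗ a (shiftBy m (a ^S m))) (xTimes-cong (⊗-shiftBy m a (a ^S m))))

  compositionSum : ℕ → ℕ → (List ℕ → Carrier) → Carrier
  compositionSum zero    zero    g = g []
  compositionSum zero    (suc n) g = 0#
  compositionSum (suc N) n       g = sumTo n (λ m → compositionSum N (n ∸ m) (λ w → g (m ∷ w)))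

  compositionSum-cong : ∀ N n {g h : List ℕ → Carrier} →
    (∀ w → length w ≡ N → sum w ≡ n → g w ≈ h w) → compositionSum N n g ≈ compositionSum N n h
  compositionSum-cong zero    zero    g≈h = g≈h [] refl refl
  compositionSum-cong zero    (suc n) g≈h = ≈-refl
  compositionSum-cong (suc N) n       g≈h = sumTo-cong n (λ m m≤n → compositionSum-cong N (n ∸ m)
    (λ w len sum-w → g≈h (m ∷ w) (cong suc len) (≡.trans (cong (m +_) sum-w) (ℕ.m+[n∸m]≡n m≤n))))

  *-distribˡ-compositionSum : ∀ N n a (g : List ℕ → Carrier) →
    a *ᴿ compositionSum N n g ≈ compositionSum N n (λ w → a *ᴿ g w)
  *-distribˡ-compositionSum zero    zero    a g = ≈-refl
  *-distribˡ-compositionSum zero    (suc n) a g = zeroʳ a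
  *-distribˡ-compositionSum (suc N) n       a g =
    ≈-trans (*-distribˡ-sumTo n a _) (sumTo-cong n (λ m _ → *-distribˡ-compositionSum N (n ∸ m) a _))

  compositionSum-+ : ∀ N n (g h : List ℕ → Carrier) →
    compositionSum N n (λ w → g w +ᴿ h w) ≈ compositionSum N n g +ᴿ compositionSum N n h
  compositionSum-+ zero    zero    g h = ≈-refl
  compositionSum-+ zero    (suc n) g h = ≈-sym (+-identityˡ 0#)
  compositionSum-+ (suc N) n       g h = ≈-trans (sumTo-cong n (λ m _ → compositionSum-+ N (n ∸ m) _ _)) (sumTo-+ n _ _)

  compositionSum-sumTo : ∀ N n M (g : ℕ → List ℕ → Carrier) →
    compositionSum N n (λ w → sumTo M (λ i → g i w)) ≈ sumTo M (λ i → compositionSum N n (g i))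
  compositionSum-sumTo N n zero    g = ≈-refl
  compositionSum-sumTo N n (suc M) g = ≈-trans (compositionSum-+ N n _ _) (+-congʳ (compositionSum-sumTo N n M g))

  ^S-compositionSum : ∀ a N n → (a ^S N) n ≈ compositionSum N n (λ w → prodList (map a w))
  ^S-compositionSum a zero    zero    = ≈-refl
  ^S-compositionSum a zero    (suc n) = ≈-refl
  ^S-compositionSum a (suc N) n       = sumTo-cong n (λ m _ →
    ≈-trans (*-congˡ (^S-compositionSum a N (n ∸ m))) (*-distribˡ-compositionSum N (n ∸ m) (a m) _))

  compositionSum-snoc : ∀ N n (g : List ℕ → Carrier) →
    compositionSum (suc N) n g ≈ sumTo n (λ m → compositionSum N (n ∸ m) (λ w → g (w ++ m ∷ [])))
  compositionSum-snoc zero    n g = sumTo-cong n (λ m _ → compositionSum-cong 0 (n ∸ m) (λ { [] _ _ → ≈-refl }))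
  compositionSum-snoc (suc N) n g = begin
    sumTo n (λ a → compositionSum (suc N) (n ∸ a) (λ w → g (a ∷ w)))
      ≈⟨ sumTo-cong n (λ a _ → compositionSum-snoc N (n ∸ a) (λ w → g (a ∷ w))) ⟩
    sumTo n (λ a → sumTo (n ∸ a) (λ m → compositionSum N (n ∸ a ∸ m) (λ w → g (a ∷ w ++ m ∷ []))))
      ≈⟨ sumTo-triangle-comm n (λ a m r → compositionSum N r (λ w → g (a ∷ w ++ m ∷ []))) ⟩
    sumTo n (λ m → sumTo (n ∸ m) (λ a → compositionSum N (n ∸ m ∸ a) (λ w → g (a ∷ w ++ m ∷ [])))) ∎

  compositionSum-rotate : ∀ N n (g : List ℕ → Carrier) →
    compositionSum N n (λ w → g (rotate w)) ≈ compositionSum N n g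
  compositionSum-rotate zero    n g = compositionSum-cong 0 n (λ { [] _ _ → ≈-refl })
  compositionSum-rotate (suc N) n g = ≈-sym (compositionSum-snoc N n g)

  compositionSum-rotate^ : ∀ i N n (g : List ℕ → Carrier) →
    compositionSum N n (λ w → g (rotate^ i w)) ≈ compositionSum N n g
  compositionSum-rotate^ zero    N n g = ≈-refl
  compositionSum-rotate^ (suc i) N n g =
    ≈-trans (compositionSum-rotate N n (λ w → g (rotate^ i w))) (compositionSum-rotate^ i N n g)

  prodList-rotate^ : ∀ (a : ℕ → Carrier) i w → prodList (map a (rotate^ i w)) ≈ prodList (map a w)
  prodList-rotate^ a i w = foldr-commMonoid setoid *-isCommutativeMonoid (↭⇒↭ₛ′ isEquivalence (map⁺ a (rotate^↭ i w)))

  -- The height recurrence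

  module Recurrence (k : ℕ) where

    below : (ℕ → Series) → ℕ → Series
    below X zero    = zeroS
    below X (suc h) = X h

    unitAt0 : ℕ → Series
    unitAt0 zero    = oneS
    unitAt0 (suc h) = zeroS

    -- (a ⋆ Z) h = Σ_m a_m x^m Z_(h+mk), and a solution satisfies X_h = [h = 0] + Σ_m φ_m x^m X_(h+mk−1),
    -- where below X supplies X_(h−1), and 0 at h = 0.
    infixl 7 _⋆_
    _⋆_ : Series → (ℕ → Series) → ℕ → Series
    (a ⋆ Z) h n = sumTo n (λ m → a m *ᴿ Z (h + m * k) (n ∸ m))

    IsSolution : Series → (ℕ → Series) → Set ℓ
    IsSolution φ X = ∀ h → X h ≋ unitAt0 h ⊕ (φ ⋆ below X) h

    ⋆-congˡ : ∀ {a b} Z h → a ≋ b → (a ⋆ Z) h ≋ (b ⋆ Z) h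
    ⋆-congˡ Z h a≋b n = sumTo-cong n (λ m _ → *-congʳ (a≋b m))

    ⋆-congʳ : ∀ a {Z Z′ : ℕ → Series} h → (∀ j → Z j ≋ Z′ j) → (a ⋆ Z) h ≋ (a ⋆ Z′) h
    ⋆-congʳ a h Z≋Z′ n = sumTo-cong n (λ m _ → *-congˡ (Z≋Z′ _ _))

    ⋆-⊕ˡ : ∀ a b Z h → ((a ⊕ b) ⋆ Z) h ≋ (a ⋆ Z) h ⊕ (b ⋆ Z) h
    ⋆-⊕ˡ a b Z h n = ≈-trans (sumTo-cong n (λ m _ → distribʳ _ _ _)) (sumTo-+ n _ _)

    ⋆-⊕ʳ : ∀ a Z Z′ h → (a ⋆ (λ j → Z j ⊕ Z′ j)) h ≋ (a ⋆ Z) h ⊕ (a ⋆ Z′) h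
    ⋆-⊕ʳ a Z Z′ h n = ≈-trans (sumTo-cong n (λ m _ → distribˡ _ _ _)) (sumTo-+ n _ _)

    ⋆-xTimesˡ : ∀ a Z h → (xTimes a ⋆ Z) h ≋ xTimes ((a ⋆ (λ j → Z (j + k))) h)
    ⋆-xTimesˡ a Z h zero    = zeroˡ _
    ⋆-xTimesˡ a Z h (suc n) = begin
      sumTo (suc n) (λ m → xTimes a m *ᴿ Z (h + m * k) (suc n ∸ m))        ≈⟨ sumTo-suc n _ ⟩
      0# *ᴿ Z (h + 0) (suc n) +ᴿ sumTo n (λ m → a m *ᴿ Z (h + suc m * k) (n ∸ m))
        ≈⟨ +-cong (zeroˡ _) (sumTo-cong n (λ m _ → *-congˡ (reflexive (cong (λ j → Z j (n ∸ m)) (height m))))) ⟩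
      0# +ᴿ sumTo n (λ m → a m *ᴿ Z (h + m * k + k) (n ∸ m))                ≈⟨ +-identityˡ _ ⟩
      sumTo n (λ m → a m *ᴿ Z (h + m * k + k) (n ∸ m))                      ∎
      where
      height : ∀ m → h + suc m * k ≡ h + m * k + k
      height m = ≡.trans (cong (h +_) (ℕ.+-comm k (m * k))) (≡.sym (ℕ.+-assoc h (m * k) k))

    ⋆-xTimesʳ : ∀ a Z h → (a ⋆ (λ j → xTimes (Z j))) h ≋ xTimes ((a ⋆ Z) h)
    ⋆-xTimesʳ a Z h zero    = zeroʳ _
    ⋆-xTimesʳ a Z h (suc n) = ≈-trans
      (+-cong (sumTo-cong n (λ m m≤n → *-congˡ (reflexive (cong (xTimes (Z (h + m * k))) (ℕ.+-∸-assoc 1 m≤n)))))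
              (*-congˡ (reflexive (cong (xTimes (Z (h + suc n * k))) (ℕ.n∸n≡0 n)))))
      (≈-trans (+-congˡ (zeroʳ _)) (+-identityʳ _))

    ⋆-⊗ : ∀ a T Z h → (a ⋆ (λ j → T ⊗ Z j)) h ≋ T ⊗ (a ⋆ Z) h
    ⋆-⊗ a T Z h n = begin
      sumTo n (λ m → a m *ᴿ sumTo (n ∸ m) (λ i → T i *ᴿ Z (h + m * k) (n ∸ m ∸ i)))
        ≈⟨ sumTo-cong n (λ m _ → ≈-trans (*-distribˡ-sumTo (n ∸ m) (a m) _) (sumTo-cong (n ∸ m) (λ i _ → x*yz≈y*xz _ _ _))) ⟩
      sumTo n (λ m → sumTo (n ∸ m) (λ i → T i *ᴿ (a m *ᴿ Z (h + m * k) (n ∸ m ∸ i))))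
        ≈⟨ sumTo-triangle-comm n (λ m i r → T i *ᴿ (a m *ᴿ Z (h + m * k) r)) ⟩
      sumTo n (λ i → sumTo (n ∸ i) (λ m → T i *ᴿ (a m *ᴿ Z (h + m * k) (n ∸ i ∸ m))))
        ≈⟨ sumTo-cong n (λ i _ → ≈-sym (*-distribˡ-sumTo (n ∸ i) (T i) _)) ⟩
      sumTo n (λ i → T i *ᴿ (a ⋆ Z) h (n ∸ i))  ∎

    compose-xTimes : ∀ F T → compose F (xTimes (T ^S k)) ≋ (F ⋆ (T ^S_)) 0
    compose-xTimes F T n = sumTo-cong n (λ m m≤n → *-congˡ (begin
      (xTimes (T ^S k) ^S m) n       ≈⟨ xTimes-^S (T ^S k) m n ⟩
      shiftBy m ((T ^S k) ^S m) n    ≡⟨ shiftBy-coeff m _ n m≤n ⟩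
      ((T ^S k) ^S m) (n ∸ m)        ≈⟨ ^S-* T k m (n ∸ m) ⟩
      (T ^S (k * m)) (n ∸ m)         ≡⟨ cong (λ e → (T ^S e) (n ∸ m)) (ℕ.*-comm k m) ⟩
      (T ^S (m * k)) (n ∸ m)         ∎))

    ⋆-^S : ∀ a T h → (a ⋆ (T ^S_)) h ≋ (T ^S h) ⊗ (a ⋆ (T ^S_)) 0
    ⋆-^S a T h = ≋-trans (λ n → sumTo-cong n (λ m _ → *-congˡ (^S-+ T h (m * k) (n ∸ m))))
                         (⋆-⊗ a (T ^S h) (T ^S_) 0)

    ⋆-onePlusX : ∀ F T → ((onePlusX ⊗ F) ⋆ (T ^S_)) 0 ≋ compose F (xTimes (T ^S k)) ⊗ (oneS ⊕ xTimes (T ^S k))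
    ⋆-onePlusX F T n = begin
      ((onePlusX ⊗ F) ⋆ (T ^S_)) 0 n                  ≈⟨ ⋆-congˡ (T ^S_) 0 (onePlusX-⊗ F) n ⟩
      ((F ⊕ xTimes F) ⋆ (T ^S_)) 0 n                  ≈⟨ ⋆-⊕ˡ F (xTimes F) (T ^S_) 0 n ⟩
      C n +ᴿ (xTimes F ⋆ (T ^S_)) 0 n                 ≈⟨ +-cong (⊗-identityʳ C n) shifted ⟨
      (C ⊗ oneS) n +ᴿ (C ⊗ xTimes (T ^S k)) n         ≈⟨ ⊗-distribˡ C oneS (xTimes (T ^S k)) n ⟨
      (C ⊗ (oneS ⊕ xTimes (T ^S k))) n                ≈⟨ ⊗-congʳ {oneS ⊕ xTimes (T ^S k)} (compose-xTimes F T) n ⟨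
      (compose F (xTimes (T ^S k)) ⊗ (oneS ⊕ xTimes (T ^S k))) n ∎
      where
      C = (F ⋆ (T ^S_)) 0
      shifted : (C ⊗ xTimes (T ^S k)) n ≈ (xTimes F ⋆ (T ^S_)) 0 n
      shifted = ≈-sym (begin
        (xTimes F ⋆ (T ^S_)) 0 n                       ≈⟨ ⋆-xTimesˡ F (T ^S_) 0 n ⟩
        xTimes ((F ⋆ (λ j → T ^S (j + k))) 0) n        ≈⟨ xTimes-cong (⋆-congʳ F 0 (λ j → ≋-trans (^S-+ T j k) (⊗-comm (T ^S j) (T ^S k)))) n ⟩
        xTimes ((F ⋆ (λ j → (T ^S k) ⊗ (T ^S j))) 0) n ≈⟨ xTimes-cong (⋆-⊗ F (T ^S k) (T ^S_) 0) n ⟩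
        xTimes ((T ^S k) ⊗ C) n                        ≈⟨ xTimes-cong (⊗-comm (T ^S k) C) n ⟩
        xTimes (C ⊗ (T ^S k)) n                        ≈⟨ ⊗-xTimes C (T ^S k) n ⟨
        (C ⊗ xTimes (T ^S k)) n                        ∎)

    module _ {φ : Series} {X Y : ℕ → Series} (X-sol : IsSolution φ X) (Y-sol : IsSolution φ Y) where

      private
        agree-at : ∀ n → (∀ {r} → r < n → ∀ h → X h r ≈ Y h r) → ∀ h → X h n ≈ Y h n
        agree-at n earlier h =
          ≈-trans (X-sol h n) (≈-trans (+-congˡ (sumTo-cong n term)) (≈-sym (Y-sol h n)))
          where
          below-agree : ∀ j → below X j n ≈ below Y j n
          below-agree zero    = ≈-refl
          below-agree (suc j) = agree-at n earlier j
          term : ∀ m → m ≤ n → φ m *ᴿ below X (h + m * k) (n ∸ m) ≈ φ m *ᴿ below Y (h + m * k) (n ∸ m)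
          term zero    _ rewrite ℕ.+-identityʳ h = *-congˡ (below-agree h)
          term (suc m) m<n with h + suc m * k
          ... | zero   = ≈-refl
          ... | suc j  = *-congˡ (earlier (ℕ.∸-monoʳ-< (s≤s z≤n) m<n) j)

      solution-unique : ∀ h → X h ≋ Y h
      solution-unique h n = <-rec _ agree-at n h

  module PositiveRecurrence (k′ : ℕ) where

    open Recurrence (suc k′) public

    private
      k : ℕ
      k = suc k′

    ⋆-unitAt0 : ∀ a h n → (a ⋆ unitAt0) h n ≈ a 0 *ᴿ unitAt0 h n
    ⋆-unitAt0 a h n = ≈-trans (sumTo-single n 0 z≤n elsewhere) (*-congˡ (reflexive (cong (λ j → unitAt0 j n) (ℕ.+-identityʳ h))))
      where
      elsewhere : ∀ m → m ≤ n → m ≢ 0 → a m *ᴿ unitAt0 (h + m * k) (n ∸ m) ≈ 0#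
      elsewhere zero    _ m≢0 = ⊥-elim (m≢0 refl)
      elsewhere (suc m) _ _ rewrite ℕ.+-suc h (k′ + m * k) = zeroʳ _

    module _ {φ : Series} {X : ℕ → Series} (φ0 : φ 0 ≈ 1#) (X-sol : IsSolution φ X) where

      solution-⋆ : ∀ h → X h ≋ (φ ⋆ (λ j → unitAt0 j ⊕ below X j)) h
      solution-⋆ h n = begin
        X h n                                        ≈⟨ X-sol h n ⟩
        unitAt0 h n +ᴿ (φ ⋆ below X) h n             ≈⟨ +-congʳ unit ⟨
        (φ ⋆ unitAt0) h n +ᴿ (φ ⋆ below X) h n       ≈⟨ ⋆-⊕ʳ φ unitAt0 (below X) h n ⟨
        (φ ⋆ (λ j → unitAt0 j ⊕ below X j)) h n      ∎
        where
        unit : (φ ⋆ unitAt0) h n ≈ unitAt0 h n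
        unit = ≈-trans (⋆-unitAt0 φ h n) (≈-trans (*-congʳ φ0) (*-identityˡ _))

      private
        Powers : ℕ → Set ℓ
        Powers n = ∀ h → X h n ≈ (X 0 ^S suc h) n

        solution-⋆-powers : ∀ n h → (∀ {r} → r < n → Powers r) →
          unitAt0 h n +ᴿ below X h n ≈ (X 0 ^S h) n → X h n ≈ (φ ⋆ (X 0 ^S_)) h n
        solution-⋆-powers n h earlier here = ≈-trans (solution-⋆ h n) (sumTo-cong n term)
          where
          term : ∀ m → m ≤ n → φ m *ᴿ (unitAt0 (h + m * k) (n ∸ m) +ᴿ below X (h + m * k) (n ∸ m))
                                ≈ φ m *ᴿ (X 0 ^S (h + m * k)) (n ∸ m)
          term zero    _   rewrite ℕ.+-identityʳ h = *-congˡ here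
          term (suc m) m≤n rewrite ℕ.+-suc h (k′ + m * k) =
            *-congˡ (≈-trans (+-identityˡ _) (earlier (ℕ.∸-monoʳ-< (s≤s z≤n) m≤n) (h + (k′ + m * k))))

        root : ∀ l → (∀ {r} → r < l → Powers r) → X 0 l ≈ (φ ⋆ (X 0 ^S_)) 0 l
        root l earlier = solution-⋆-powers l 0 earlier (+-identityʳ _)

        powers-at : ∀ n → (∀ {r} → r < n → Powers r) → Powers n
        powers-at n earlier zero    = ≈-sym (⊗-identityʳ (X 0) n)
        powers-at n earlier (suc h) = begin
          X (suc h) n                                 ≈⟨ solution-⋆-powers n (suc h) earlier (≈-trans (+-identityˡ _) (powers-at n earlier h)) ⟩
          (φ ⋆ (X 0 ^S_)) (suc h) n                   ≈⟨ ⋆-^S φ (X 0) (suc h) n ⟩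
          ((X 0 ^S suc h) ⊗ (φ ⋆ (X 0 ^S_)) 0) n      ≈⟨ sumTo-cong n (λ i _ → *-congˡ (≈-sym (root (n ∸ i) (λ r< → earlier (ℕ.≤-trans r< (ℕ.m∸n≤m n i)))))) ⟩
          ((X 0 ^S suc h) ⊗ X 0) n                    ≈⟨ ⊗-comm (X 0 ^S suc h) (X 0) n ⟩
          (X 0 ^S suc (suc h)) n                      ∎

      solution-powers : ∀ h → X h ≋ X 0 ^S suc h
      solution-powers h n = <-rec _ powers-at n h

      solution-root : X 0 ≋ (φ ⋆ (X 0 ^S_)) 0
      solution-root l = root l (λ {r} _ h → solution-powers h r)

    module Lukasiewicz (φ : Series) where

      Πφ : List ℕ → Carrier
      Πφ w = prodList (map φ w)

      wordSeries : ℕ → Series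
      wordSeries h n = compositionSum (h + n * k) n (λ w → indicator (returnsFrom h (map (_* k) w)) *ᴿ Πφ w)

      private
        length-after : ∀ h n N m q → h + n * k ≡ suc N → m ≤ n → h + m * k ≡ suc q → N ≡ q + (n ∸ m) * k
        length-after h n N m q hn m≤n hm = ℕ.suc-injective (≡.trans (≡.sym hn) (≡.trans
          (cong (λ z → h + z * k) (≡.sym (ℕ.m+[n∸m]≡n m≤n)))
          (≡.trans (cong (h +_) (ℕ.*-distribʳ-+ k m (n ∸ m)))
          (≡.trans (≡.sym (ℕ.+-assoc h (m * k) _)) (cong (_+ (n ∸ m) * k) hm)))))

        wordSeries-term : ∀ h n N m → h + n * k ≡ suc N → m ≤ n →
          compositionSum N (n ∸ m) (λ w → indicator (returnsDown (h + m * k) (map (_* k) w)) *ᴿ Πφ (m ∷ w))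
            ≈ φ m *ᴿ below wordSeries (h + m * k) (n ∸ m)
        wordSeries-term h n N m hn m≤n with h + m * k in hm
        ... | zero  = begin
          compositionSum N (n ∸ m) (λ w → 0# *ᴿ Πφ (m ∷ w))   ≈⟨ *-distribˡ-compositionSum N (n ∸ m) 0# _ ⟨
          0# *ᴿ compositionSum N (n ∸ m) (λ w → Πφ (m ∷ w))   ≈⟨ zeroˡ _ ⟩
          0#                                                  ≈⟨ zeroʳ (φ m) ⟨
          φ m *ᴿ 0#                                           ∎
        ... | suc q rewrite length-after h n N m q hn m≤n hm = begin
          compositionSum (q + (n ∸ m) * k) (n ∸ m) (λ w → indicator (returnsFrom q (map (_* k) w)) *ᴿ (φ m *ᴿ Πφ w))
            ≈⟨ compositionSum-cong (q + (n ∸ m) * k) (n ∸ m) (λ w _ _ → x*yz≈y*xz _ _ _) ⟩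
          compositionSum (q + (n ∸ m) * k) (n ∸ m) (λ w → φ m *ᴿ (indicator (returnsFrom q (map (_* k) w)) *ᴿ Πφ w))
            ≈⟨ *-distribˡ-compositionSum (q + (n ∸ m) * k) (n ∸ m) (φ m) _ ⟨
          φ m *ᴿ wordSeries q (n ∸ m)                                                                ∎

        wordSeries-step : ∀ h n N → h + n * k ≡ suc N → wordSeries h n ≈ (φ ⋆ below wordSeries) h n
        wordSeries-step h n N hn = ≈-trans
          (reflexive (cong (λ L → compositionSum L n (λ w → indicator (returnsFrom h (map (_* k) w)) *ᴿ Πφ w)) hn))
          (sumTo-cong n (λ m m≤n → wordSeries-term h n N m hn m≤n))

      wordSeries-solution : IsSolution φ wordSeries
      wordSeries-solution zero    zero    = ≈-trans (*-identityˡ _) (≈-sym (≈-trans (+-congˡ (zeroʳ _)) (+-identityʳ _)))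
      wordSeries-solution zero    (suc n) = ≈-trans (wordSeries-step zero (suc n) (k′ + n * k) refl) (≈-sym (+-identityˡ _))
      wordSeries-solution (suc h) n       = ≈-trans (wordSeries-step (suc h) n (h + n * k) refl) (≈-sym (+-identityˡ _))

      private
        exitWeight : List ℕ → Carrier
        exitWeight w = indicator (exitsFrom 0 (map (_* k) w)) *ᴿ Πφ w

        cycle-count : ∀ n N → suc (n * k) ≡ N → compositionSum N n Πφ ≈ natMul N (compositionSum N n exitWeight)
        cycle-count n N N≡ = begin
          compositionSum N n Πφ
            ≈⟨ compositionSum-cong N n (λ w len total → ≈-trans (≈-sym (*-identityˡ _)) (*-congʳ (≈-sym (one-exit w len total)))) ⟩
          compositionSum N n (λ w → sumTo M (λ i → exits w i) *ᴿ Πφ w)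
            ≈⟨ compositionSum-cong N n (λ w _ _ → *-distribʳ-sumTo M (Πφ w) _) ⟩
          compositionSum N n (λ w → sumTo M (λ i → exits w i *ᴿ Πφ w))
            ≈⟨ compositionSum-sumTo N n M _ ⟩
          sumTo M (λ i → compositionSum N n (λ w → exits w i *ᴿ Πφ w))
            ≈⟨ sumTo-cong M (λ i _ → compositionSum-cong N n (λ w _ _ → *-congˡ (≈-sym (prodList-rotate^ φ i w)))) ⟩
          sumTo M (λ i → compositionSum N n (λ w → exitWeight (rotate^ i w)))
            ≈⟨ sumTo-cong M (λ i _ → compositionSum-rotate^ i N n exitWeight) ⟩
          sumTo M (λ _ → compositionSum N n exitWeight)
            ≈⟨ sumTo-const M _ ⟩
          natMul (suc M) (compositionSum N n exitWeight)
            ≡⟨ cong (λ L → natMul L (compositionSum N n exitWeight)) N≡ ⟩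
          natMul N (compositionSum N n exitWeight) ∎
          where
          M = n * k
          exits : List ℕ → ℕ → Carrier
          exits w i = indicator (exitsFrom 0 (map (_* k) (rotate^ i w)))
          one-exit : ∀ w → length w ≡ N → sum w ≡ n → sumTo M (exits w) ≈ 1#
          one-exit w len total with cycle-lemma M (map (_* k) w) (≡.trans (length-map (_* k) w) (≡.trans len (≡.sym N≡)))
                                                 (≡.trans (sum-map-*ʳ k w) (cong (_* k) total))
          ... | i , i≤M , exit-i , unique = sumTo-indicator-unique M _ i i≤M
            (≡.trans (cong (exitsFrom 0) (map-rotate^ (_* k) i w)) exit-i)
            (λ j j≤M exit-j → unique j j≤M (≡.trans (cong (exitsFrom 0) (≡.sym (map-rotate^ (_* k) j w))) exit-j))

        exitWeight-sum : φ 0 ≈ 1# → ∀ n → compositionSum (suc (n * k)) n exitWeight ≈ wordSeries 0 n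
        exitWeight-sum φ0 n = begin
          compositionSum (suc (n * k)) n exitWeight
            ≈⟨ compositionSum-snoc (n * k) n exitWeight ⟩
          sumTo n (λ m → compositionSum (n * k) (n ∸ m) (λ w → exitWeight (w ++ m ∷ [])))
            ≈⟨ sumTo-single n 0 z≤n last-positive ⟩
          compositionSum (n * k) n (λ w → exitWeight (w ++ 0 ∷ []))
            ≈⟨ compositionSum-cong (n * k) n (λ w _ _ → last-zero w) ⟩
          wordSeries 0 n ∎
          where
          exits-snoc : ∀ w m → exitsFrom 0 (map (_* k) (w ++ m ∷ [])) ≡ (returnsFrom 0 (map (_* k) w) ∧ (m * k ≡ᵇ 0))
          exits-snoc w m = ≡.trans (cong (exitsFrom 0) (map-++ (_* k) w (m ∷ []))) (exitsFrom-snoc 0 (map (_* k) w) (m * k))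
          last-positive : ∀ m → m ≤ n → m ≢ 0 → compositionSum (n * k) (n ∸ m) (λ w → exitWeight (w ++ m ∷ [])) ≈ 0#
          last-positive zero    _ m≢0 = ⊥-elim (m≢0 refl)
          last-positive (suc m) _ _   = begin
            compositionSum (n * k) (n ∸ suc m) (λ w → exitWeight (w ++ suc m ∷ []))
              ≈⟨ compositionSum-cong (n * k) (n ∸ suc m) (λ w _ _ →
                   *-congʳ (reflexive (cong indicator (≡.trans (exits-snoc w (suc m)) (∧-zeroʳ _))))) ⟩
            compositionSum (n * k) (n ∸ suc m) (λ w → 0# *ᴿ Πφ (w ++ suc m ∷ []))
              ≈⟨ *-distribˡ-compositionSum (n * k) (n ∸ suc m) 0# _ ⟨
            0# *ᴿ _                                                            ≈⟨ zeroˡ _ ⟩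
            0#                                                                 ∎
          last-zero : ∀ w → exitWeight (w ++ 0 ∷ []) ≈ indicator (returnsFrom 0 (map (_* k) w)) *ᴿ Πφ w
          last-zero w = *-cong (reflexive (cong indicator (≡.trans (exits-snoc w 0) (∧-identityʳ _))))
            (≈-trans (prodList-rotate^ φ 1 (0 ∷ w)) (≈-trans (*-congʳ φ0) (*-identityˡ _)))

      lagrange : φ 0 ≈ 1# → ∀ n → natMul (suc (n * k)) (wordSeries 0 n) ≈ (φ ^S suc (n * k)) n
      lagrange φ0 n = begin
        natMul N (wordSeries 0 n)                     ≈⟨ natMul-cong N (exitWeight-sum φ0 n) ⟨
        natMul N (compositionSum N n exitWeight)      ≈⟨ cycle-count n N refl ⟨
        compositionSum N n Πφ                         ≈⟨ ^S-compositionSum φ N n ⟨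
        (φ ^S N) n                                    ∎
        where N = suc (n * k)

  -- Schröder paths

  module SchroderPaths (f : ℕ → Carrier) (k′ : ℕ) where

    open PositiveRecurrence k′

    private
      k : ℕ
      k = suc k′

      F : Series
      F = Fser f

    -- c is the length of the block of steps U that precedes w.
    runWeight : ℕ → List Step → Carrier
    runWeight c w = prodList (map f (runsAcc c w))

    validSum : ℕ → ℕ → List (List Step) → Carrier
    validSum c h ws = sumList (map (runWeight c) (filterᵇ (validFrom k h) ws))

    weightedPaths : ℕ → ℕ → ℕ → Carrier
    weightedPaths c h L = validSum c h (words L)

    private
      validFrom-U : ∀ h s → validFrom k h (U ∷ s) ≡ validFrom k (h + k) s
      validFrom-U zero    s = refl
      validFrom-U (suc h) s = refl

      validFrom-H : ∀ h s → validFrom k h (H ∷ s) ≡ validFrom k (h + k′) s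
      validFrom-H zero    s = refl
      validFrom-H (suc h) s = refl

      runWeight-U : ∀ c s → runWeight c (U ∷ s) ≈ runWeight (suc c) s
      runWeight-U zero    s = ≈-refl
      runWeight-U (suc c) s = ≈-refl

      runWeight-H : ∀ c s → runWeight c (H ∷ s) ≈ F c *ᴿ runWeight 0 s
      runWeight-H zero    s = ≈-sym (*-identityˡ _)
      runWeight-H (suc c) s = ≈-refl

      runWeight-D : ∀ c s → runWeight c (D ∷ s) ≈ F c *ᴿ runWeight 0 s
      runWeight-D zero    s = ≈-sym (*-identityˡ _)
      runWeight-D (suc c) s = ≈-refl

    validSum-++ : ∀ c h xs ys → validSum c h (xs ++ ys) ≈ validSum c h xs +ᴿ validSum c h ys
    validSum-++ c h []       ys = ≈-sym (+-identityˡ _)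
    validSum-++ c h (x ∷ xs) ys with validFrom k h x
    ... | true  = ≈-trans (+-congˡ (validSum-++ c h xs ys)) (≈-sym (+-assoc _ _ _))
    ... | false = validSum-++ c h xs ys

    validSum-U : ∀ c h ws → validSum c h (map (U ∷_) ws) ≈ validSum (suc c) (h + k) ws
    validSum-U c h ws = sumList-filter-map _ _ _ _ (U ∷_) ws (validFrom-U h) (runWeight-U c)

    validSum-H : ∀ c h ws → validSum c h (map (H ∷_) ws) ≈ F c *ᴿ validSum 0 (h + k′) ws
    validSum-H c h ws = ≈-trans (sumList-filter-map _ _ _ _ (H ∷_) ws (validFrom-H h) (runWeight-H c))
                                (≈-sym (*-distribˡ-sumList (F c) (runWeight 0) (filterᵇ (validFrom k (h + k′)) ws)))

    validSum-D : ∀ c h ws → validSum c (suc h) (map (D ∷_) ws) ≈ F c *ᴿ validSum 0 h ws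
    validSum-D c h ws = ≈-trans (sumList-filter-map _ _ _ _ (D ∷_) ws (λ _ → refl) (runWeight-D c))
                                (≈-sym (*-distribˡ-sumList (F c) (runWeight 0) (filterᵇ (validFrom k h) ws)))

    validSum-D-ground : ∀ c ws → validSum c 0 (map (D ∷_) ws) ≈ 0#
    validSum-D-ground c []       = ≈-refl
    validSum-D-ground c (w ∷ ws) = validSum-D-ground c ws

    private
      wordsAfterH : ℕ → List (List Step)
      wordsAfterH zero    = []
      wordsAfterH (suc L) = map (H ∷_) (words L)

      words-suc : ∀ L → words (suc L) ≡ map (U ∷_) (words L) ++ map (D ∷_) (words L) ++ wordsAfterH L
      words-suc zero    = refl
      words-suc (suc L) = refl

      afterD : ℕ → ℕ → Carrier
      afterD zero    L = 0#
      afterD (suc h) L = weightedPaths 0 h L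

      afterH : ℕ → ℕ → Carrier
      afterH h zero    = 0#
      afterH h (suc L) = weightedPaths 0 (h + k′) L

    weightedPaths-suc : ∀ c h L →
      weightedPaths c h (suc L) ≈ weightedPaths (suc c) (h + k) L +ᴿ F c *ᴿ (afterD h L +ᴿ afterH h L)
    weightedPaths-suc c h L = begin
      validSum c h (words (suc L))
        ≡⟨ cong (validSum c h) (words-suc L) ⟩
      validSum c h (map (U ∷_) (words L) ++ map (D ∷_) (words L) ++ wordsAfterH L)
        ≈⟨ ≈-trans (validSum-++ c h (map (U ∷_) (words L)) _) (+-congˡ (validSum-++ c h (map (D ∷_) (words L)) (wordsAfterH L))) ⟩
      validSum c h (map (U ∷_) (words L)) +ᴿ (validSum c h (map (D ∷_) (words L)) +ᴿ validSum c h (wordsAfterH L))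
        ≈⟨ +-cong (validSum-U c h (words L)) (≈-trans (+-cong (down h) (flat L)) (≈-sym (distribˡ _ _ _))) ⟩
      weightedPaths (suc c) (h + k) L +ᴿ F c *ᴿ (afterD h L +ᴿ afterH h L) ∎
      where
      down : ∀ h → validSum c h (map (D ∷_) (words L)) ≈ F c *ᴿ afterD h L
      down zero    = ≈-trans (validSum-D-ground c (words L)) (≈-sym (zeroʳ _))
      down (suc h) = validSum-D c h (words L)
      flat : ∀ L → validSum c h (wordsAfterH L) ≈ F c *ᴿ afterH h L
      flat zero    = ≈-sym (zeroʳ _)
      flat (suc L) = validSum-H c h (words L)

    weightedPaths-nil : ∀ c → weightedPaths c 0 0 ≈ F c
    weightedPaths-nil zero    = +-identityʳ _
    weightedPaths-nil (suc c) = ≈-trans (+-identityʳ _) (*-identityʳ _)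

    weightedPaths-vanish : ∀ c h L → L < h → weightedPaths c h L ≈ 0#
    weightedPaths-vanish c (suc h) zero    _           = ≈-refl
    weightedPaths-vanish c h       (suc L) 1+L<h = begin
      weightedPaths c h (suc L)                                          ≈⟨ weightedPaths-suc c h L ⟩
      weightedPaths (suc c) (h + k) L +ᴿ F c *ᴿ (afterD h L +ᴿ afterH h L)
        ≈⟨ +-cong (weightedPaths-vanish (suc c) (h + k) L (ℕ.≤-trans L<h (ℕ.m≤m+n h k)))
                  (*-congˡ (+-cong (down h 1+L<h) (flat L L<h))) ⟩
      0# +ᴿ F c *ᴿ (0# +ᴿ 0#)                                            ≈⟨ ≈-trans (+-identityˡ _) (≈-trans (*-congˡ (+-identityʳ 0#)) (zeroʳ _)) ⟩
      0#                                                                 ∎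
      where
      L<h : L < h
      L<h = ℕ.<-trans (ℕ.n<1+n L) 1+L<h
      down : ∀ h → suc L < h → afterD h L ≈ 0#
      down (suc h) (s≤s L<h) = weightedPaths-vanish 0 h L L<h
      flat : ∀ L → L < h → afterH h L ≈ 0#
      flat zero    _   = ≈-refl
      flat (suc L) 1+L<h = weightedPaths-vanish 0 (h + k′) L (ℕ.≤-trans (ℕ.<-trans (ℕ.n<1+n L) 1+L<h) (ℕ.m≤m+n h k′))

    -- A path from height h to 0 with n steps U or H has x-length h + (k + 1) n.
    pathSeries : ℕ → ℕ → Series
    pathSeries c h n = weightedPaths c h (h + (k + 1) * n)

    -- After its first maximal block of steps U a path ends, or goes on with D and a path from
    -- h − 1, or with H (counted in n) and a path from h + k − 1.
    afterRun : ℕ → Series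
    afterRun h = (unitAt0 h ⊕ below (pathSeries 0) h) ⊕ xTimes (pathSeries 0 (h + k′))

    private
      length-zero : ∀ h → h + (k + 1) * 0 ≡ h
      length-zero h = ≡.trans (cong (h +_) (ℕ.*-zeroʳ (k + 1))) (ℕ.+-identityʳ h)

      length-suc : ∀ h n → h + (k + 1) * suc n ≡ suc (h + k + (k + 1) * n)
      length-suc h n = solve 3 (λ h n j → h :+ ((con 1 :+ j) :+ con 1) :* (con 1 :+ n)
                                        := con 1 :+ ((h :+ (con 1 :+ j)) :+ ((con 1 :+ j) :+ con 1) :* n)) refl h n k′
        where open +-*-Solver

    pathSeries-zero : ∀ c h → pathSeries c h 0 ≈ F c *ᴿ afterRun h 0
    pathSeries-zero c zero = begin
      weightedPaths c 0 (0 + (k + 1) * 0)  ≡⟨ cong (weightedPaths c 0) (length-zero 0) ⟩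
      weightedPaths c 0 0                  ≈⟨ weightedPaths-nil c ⟩
      F c                                  ≈⟨ *-identityʳ _ ⟨
      F c *ᴿ 1#                            ≈⟨ *-congˡ (≈-trans (+-identityʳ _) (+-identityʳ _)) ⟨
      F c *ᴿ ((1# +ᴿ 0#) +ᴿ 0#)            ∎
    pathSeries-zero c (suc q) = begin
      weightedPaths c (suc q) (suc q + (k + 1) * 0)   ≡⟨ cong (weightedPaths c (suc q)) (length-zero (suc q)) ⟩
      weightedPaths c (suc q) (suc q)                 ≈⟨ weightedPaths-suc c (suc q) q ⟩
      weightedPaths (suc c) (suc q + k) q +ᴿ F c *ᴿ (weightedPaths 0 q q +ᴿ afterH (suc q) q)
        ≈⟨ +-cong (weightedPaths-vanish (suc c) (suc q + k) q (s≤s (ℕ.m≤m+n q k))) (*-congˡ (+-congˡ (flat q))) ⟩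
      0# +ᴿ F c *ᴿ (weightedPaths 0 q q +ᴿ 0#)        ≈⟨ +-identityˡ _ ⟩
      F c *ᴿ (weightedPaths 0 q q +ᴿ 0#)              ≈⟨ *-congˡ (+-congʳ (≈-trans (+-identityˡ _) (reflexive (cong (weightedPaths 0 q) (length-zero q))))) ⟨
      F c *ᴿ ((0# +ᴿ pathSeries 0 q 0) +ᴿ 0#)         ∎
      where
      flat : ∀ q → afterH (suc q) q ≈ 0#
      flat zero    = ≈-refl
      flat (suc q) = weightedPaths-vanish 0 (suc (suc q) + k′) q (ℕ.≤-trans (ℕ.n≤1+n _) (s≤s (s≤s (ℕ.m≤m+n q k′))))

    pathSeries-suc : ∀ c h n → pathSeries c h (suc n) ≈ F c *ᴿ afterRun h (suc n) +ᴿ pathSeries (suc c) (h + k) n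
    pathSeries-suc c h n = begin
      weightedPaths c h (h + (k + 1) * suc n)         ≡⟨ cong (weightedPaths c h) (length-suc h n) ⟩
      weightedPaths c h (suc L)                       ≈⟨ weightedPaths-suc c h L ⟩
      pathSeries (suc c) (h + k) n +ᴿ F c *ᴿ (afterD h L +ᴿ afterH h L)
        ≈⟨ +-congˡ (*-congˡ (+-cong (down h) (reflexive (cong (afterH h) (cong (_+ (k + 1) * n) (ℕ.+-suc h k′)))))) ⟩
      pathSeries (suc c) (h + k) n +ᴿ F c *ᴿ afterRun h (suc n) ≈⟨ +-comm _ _ ⟩
      F c *ᴿ afterRun h (suc n) +ᴿ pathSeries (suc c) (h + k) n ∎
      where
      L = h + k + (k + 1) * n
      down : ∀ h → afterD h (h + k + (k + 1) * n) ≈ unitAt0 h (suc n) +ᴿ below (pathSeries 0) h (suc n)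
      down zero    = ≈-sym (+-identityʳ _)
      down (suc q) = ≈-sym (≈-trans (+-identityˡ _) (reflexive (cong (weightedPaths 0 q) (length-suc q n))))

    pathSeries-runs : ∀ n c h → pathSeries c h n ≈ ((λ m → F (m + c)) ⋆ afterRun) h n
    pathSeries-runs zero    c h = ≈-trans (pathSeries-zero c h) (*-congˡ (reflexive (cong (λ j → afterRun j 0) (≡.sym (ℕ.+-identityʳ h)))))
    pathSeries-runs (suc n) c h = begin
      pathSeries c h (suc n)                                                  ≈⟨ pathSeries-suc c h n ⟩
      F c *ᴿ afterRun h (suc n) +ᴿ pathSeries (suc c) (h + k) n
        ≈⟨ +-cong (*-congˡ (reflexive (cong (λ j → afterRun j (suc n)) (≡.sym (ℕ.+-identityʳ h))))) (pathSeries-runs n (suc c) (h + k)) ⟩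
      F c *ᴿ afterRun (h + 0) (suc n) +ᴿ ((λ m → F (m + suc c)) ⋆ afterRun) (h + k) n
        ≈⟨ +-congˡ (sumTo-cong n (λ m _ → reflexive (cong₂ (λ i j → F i *ᴿ afterRun j (n ∸ m)) (ℕ.+-suc m c) (ℕ.+-assoc h k (m * k))))) ⟩
      F c *ᴿ afterRun (h + 0) (suc n) +ᴿ sumTo n (λ m → F (suc m + c) *ᴿ afterRun (h + suc m * k) (n ∸ m))
        ≈⟨ sumTo-suc n _ ⟨
      ((λ m → F (m + c)) ⋆ afterRun) h (suc n)                               ∎

    pathSeries-solution : IsSolution (onePlusX ⊗ F) (pathSeries 0)
    pathSeries-solution h n = begin
      P h n                                                       ≈⟨ pathSeries-runs n 0 h ⟩
      ((λ m → F (m + 0)) ⋆ afterRun) h n                          ≈⟨ ⋆-congˡ afterRun h (λ m → reflexive (cong F (ℕ.+-identityʳ m))) n ⟩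
      (F ⋆ afterRun) h n                                          ≈⟨ ⋆-⊕ʳ F (λ j → unitAt0 j ⊕ below P j) (λ j → xTimes (P (j + k′))) h n ⟩
      (F ⋆ (λ j → unitAt0 j ⊕ below P j)) h n +ᴿ (F ⋆ (λ j → xTimes (P (j + k′)))) h n
        ≈⟨ +-cong (⋆-⊕ʳ F unitAt0 (below P) h n) (⋆-xTimesʳ F (λ j → P (j + k′)) h n) ⟩
      ((F ⋆ unitAt0) h n +ᴿ (F ⋆ below P) h n) +ᴿ xTimes ((F ⋆ (λ j → P (j + k′))) h) n
        ≈⟨ +-cong (+-congʳ (≈-trans (⋆-unitAt0 F h n) (*-identityˡ _))) shifted ⟩
      (unitAt0 h n +ᴿ (F ⋆ below P) h n) +ᴿ (xTimes F ⋆ below P) h n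
        ≈⟨ ≈-trans (+-assoc _ _ _) (+-congˡ (≈-sym (⋆-⊕ˡ F (xTimes F) (below P) h n))) ⟩
      unitAt0 h n +ᴿ ((F ⊕ xTimes F) ⋆ below P) h n               ≈⟨ +-congˡ (⋆-congˡ (below P) h (onePlusX-⊗ F) n) ⟨
      unitAt0 h n +ᴿ ((onePlusX ⊗ F) ⋆ below P) h n               ∎
      where
      P = pathSeries 0
      below-+k : ∀ j → below P (j + k) ≋ P (j + k′)
      below-+k j rewrite ℕ.+-suc j k′ = ≋-refl
      shifted : xTimes ((F ⋆ (λ j → P (j + k′))) h) n ≈ (xTimes F ⋆ below P) h n
      shifted = ≈-sym (≈-trans (⋆-xTimesˡ F (below P) h n) (xTimes-cong (⋆-congʳ F h below-+k) n))

theorem4p1 : ∀ {c ℓ : Level} (R : CommutativeRing c ℓ) →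
    let open WithRing R
    in (f : ℕ → Carrier) (k : ℕ) → 1 ≤ k →
       ((n : ℕ) →
          natMul (k * n + 1) (sSeq f k n)
            ≈ ((onePlusX ^S (k * n + 1)) ⊗ (Fser f ^S (k * n + 1))) n)
       ×
       ((n : ℕ) →
          sSeq f k n
            ≈ (compose (Fser f) (xTimes (sSeq f k ^S k)) ⊗ (oneS ⊕ xTimes (sSeq f k ^S k))) n)
theorem4p1 R f zero ()
theorem4p1 R f (suc k′) _ = lagrange-inversion , functional-equation
  where
  open WithRing R
  open CommutativeRing R using (setoid; 1#; *-identityˡ)
  open Relation.Binary.Reasoning.Setoid setoid
  open PowerSeries R
  open PositiveRecurrence k′
  open SchroderPaths f k′ using (pathSeries; pathSeries-solution)

  φ : Series
  φ = onePlusX ⊗ Fser f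

  open Lukasiewicz φ using (wordSeries; wordSeries-solution; lagrange)

  φ0 : φ 0 ≈ 1#
  φ0 = *-identityˡ 1#

  lagrange-inversion : ∀ n → natMul (suc k′ * n + 1) (sSeq f (suc k′) n)
                               ≈ ((onePlusX ^S (suc k′ * n + 1)) ⊗ (Fser f ^S (suc k′ * n + 1))) n
  lagrange-inversion n rewrite ℕ.+-comm (suc k′ * n) 1 | ℕ.*-comm (suc k′) n = begin
    natMul N (pathSeries 0 0 n)            ≈⟨ natMul-cong N (solution-unique pathSeries-solution wordSeries-solution 0 n) ⟩
    natMul N (wordSeries 0 n)              ≈⟨ lagrange φ0 n ⟩
    (φ ^S N) n                             ≈⟨ ^S-distrib-⊗ onePlusX (Fser f) N n ⟩
    ((onePlusX ^S N) ⊗ (Fser f ^S N)) n    ∎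
    where N = suc (n * suc k′)

  functional-equation : ∀ n → sSeq f (suc k′) n
    ≈ (compose (Fser f) (xTimes (sSeq f (suc k′) ^S suc k′)) ⊗ (oneS ⊕ xTimes (sSeq f (suc k′) ^S suc k′))) n
  functional-equation n = begin
    pathSeries 0 0 n                         ≈⟨ solution-root φ0 pathSeries-solution n ⟩
    (φ ⋆ (pathSeries 0 0 ^S_)) 0 n           ≈⟨ ⋆-onePlusX (Fser f) (pathSeries 0 0) n ⟩
    (compose (Fser f) (xTimes (pathSeries 0 0 ^S suc k′)) ⊗ (oneS ⊕ xTimes (pathSeries 0 0 ^S suc k′))) n ∎
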